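{- Let $F=\langle W,R,\{S_x\}_{x\in W}\rangle$ be any $\mathbf{ILS}$-frame. Then the schema $\mathbf{J4}_+$: $\Box(A\to B)\to(C\rhd A\to C\rhd B)$ is valid in $F$ if and only if for all $x,y\in W$ and all $V\subseteq W$, if $yS_xV$ then $yS_x(V\cap R[x])$, where $R[x]=\{y\in W: xRy\}$.
   Context: Formulas are built from propositional variables, $\top,\bot$, $\neg,\land,\lor,\to$, unary $\Box$ and binary $\rhd$. An $\mathbf{ILS}$-frame is a triple $\langle W,R,\{S_x\}_{x\in W}\rangle$ with $W$ nonempty, $R$ transitive and conversely well-founded on $W$, each $S_x\subseteq W\times(\mathcal P(W)\setminus\{\emptyset\})$ such that $yS_xV$ implies $xRy$, and (monotonicity) $yS_xV$ and $V\subseteq U$ imply $yS_xU$. Satisfaction: usual Boolean clauses, $x\Vdash\Box A$ iff $y\Vdash A$ for all $y$ with $xRy$, and $x\Vdash A\rhd B$ iff for every $y$ with $xRy$ and $y\Vdash A$ there is $V\subseteq W$ with $yS_xV$ and $z\Vdash B$ for all $z\in V$. A schema is valid in a frame if every instance holds at every point under every satisfaction relation. -}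

module Defs where

open import Data.Nat using (ℕ)
open import Data.Product using (Σ; _×_; _,_; ∃)
open import Level using (Lift; 0ℓ)
open import Data.Unit.Polymorphic using (⊤)
open import Data.Empty.Polymorphic using (⊥)
open import Data.Sum using (_⊎_)
open import Relation.Binary using (Transitive)
open import Induction.WellFounded using (WellFounded)
open import Function using (flip)

data Fm : Set where
  var   : ℕ → Fm
  ⊤'    : Fm
  ⊥'    : Fm
  ¬'_   : Fm → Fm
  _∧'_  : Fm → Fm → Fm
  _∨'_  : Fm → Fm → Fm
  _⇒_   : Fm → Fm → Fm
  □_    : Fm → Fm
  _▷_   : Fm → Fm → Fm

infixr 5 _⇒_
infix 6 _▷_

Subset : Set → Set₁
Subset W = W → Set

_⊆_ : {W : Set} → Subset W → Subset W → Set
V ⊆ U = ∀ z → V z → U z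

_∩_ : {W : Set} → Subset W → Subset W → Subset W
(V ∩ U) z = V z × U z

record ILSFrame : Set₁ where
  field
    W      : Set
    inhab  : W
    R      : W → W → Set
    S      : W → W → Subset W → Set             -- S x y V  means  y S_x V
    R-trans : Transitive R
    R-cwf   : WellFounded (flip R)
    S-nonempty : ∀ {x y V} → S x y V → ∃ λ z → V z
    S-R     : ∀ {x y V} → S x y V → R x y
    S-mono  : ∀ {x y V U} → S x y V → V ⊆ U → S x y U

  R[_] : W → Subset W
  R[ x ] y = R x y

module _ (F : ILSFrame) where
  open ILSFrame F

  Valuation : Set₁
  Valuation = ℕ → W → Set

  -- satisfaction relation (valued in Set₁ since ▷ quantifies over subsets)
  sat : Valuation → W → Fm → Set₁
  sat v x (var p) = Lift (Level.suc 0ℓ) (v p x)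
  sat v x ⊤' = ⊤ {Level.suc 0ℓ}
  sat v x ⊥' = ⊥ {Level.suc 0ℓ}
  sat v x (¬' A) = sat v x A → ⊥ {Level.suc 0ℓ}
  sat v x (A ∧' B) = sat v x A × sat v x B
  sat v x (A ∨' B) = sat v x A ⊎ sat v x B
  sat v x (A ⇒ B) = sat v x A → sat v x B
  sat v x (□ A) = ∀ y → R x y → sat v y A
  sat v x (A ▷ B) = ∀ y → R x y → sat v y A →
                    Σ (Subset W) λ V → S x y V × (∀ z → V z → sat v z B)

  J4+-valid : Set₁
  J4+-valid = ∀ (A B C : Fm) (v : Valuation) (x : W) →
              sat v x (□ (A ⇒ B) ⇒ (C ▷ A ⇒ C ▷ B))

  J4+-condition : Set₁
  J4+-condition = ∀ (x y : W) (V : Subset W) → S x y V → S x y (V ∩ R[ x ])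

module Submission where

-- Soundness (condition ⇒ validity).  Given C ▷ A at x and a C-point y, take
-- an A-witness V with y S_x V.  The condition lets us pass to V ∩ R[x], whose
-- points are A-points seen from x, hence B-points by □(A → B).
--
-- Completeness (validity ⇒ condition).  Given y S_x V, interpret
-- p₀ := V, p₁ := R[x], p₂ := {y}.  Then □(p₀ → p₀ ∧ p₁) and p₂ ▷ p₀ hold at x
-- (the latter witnessed by V itself), so J4₊ yields p₂ ▷ (p₀ ∧ p₁) at x.
-- Applied at y this gives some U with y S_x U and U ⊆ V ∩ R[x]; monotonicity
-- of S_x lifts it to y S_x (V ∩ R[x]).

open import Defs
open import Function.Bundles using (_⇔_; mk⇔)
open import Data.Nat using (zero; suc)
open import Data.Product using (_×_; _,_)
open import Level using (lift)
open import Relation.Binary.PropositionalEquality using (_≡_; refl)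

module _ (F : ILSFrame) where
  open ILSFrame F

  -- Under the frame condition, an S_x-neighbourhood of y all of whose points
  -- have property P can be replaced by one whose points have P and are
  -- R-successors of x.  (P may be a large predicate such as satisfaction.)
  restrict-neighbourhood : ∀ {ℓ} → J4+-condition F → ∀ {x y V} {P : W → Set ℓ} →
                           S x y V → (∀ z → V z → P z) →
                           S x y (V ∩ R[ x ]) × (∀ z → (V ∩ R[ x ]) z → P z × R x z)
  restrict-neighbourhood cond {x} {y} {V} yS V⊨P =
    cond x y V yS , λ z (Vz , xRz) → V⊨P z Vz , xRz

  -- Soundness: restrict the C ▷ A witness to R[x] and apply □(A → B) there.
  condition⇒valid : J4+-condition F → J4+-valid F
  condition⇒valid cond A B C v x □A⇒B C▷A y xRy Cy =
    let V , yS , V⊨A = C▷A y xRy Cy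
        yS′ , V′⊆ = restrict-neighbourhood cond yS V⊨A
    in V ∩ R[ x ] , yS′ , λ z z∈V′ → let Az , xRz = V′⊆ z z∈V′ in □A⇒B z xRz Az

  separating : (x y : W) → Subset W → Valuation F
  separating x y V zero          = V
  separating x y V (suc zero)    = R[ x ]
  separating x y V (suc (suc _)) = y ≡_

  separating-□ : ∀ x y V → sat F (separating x y V) x (□ (var 0 ⇒ var 0 ∧' var 1))
  separating-□ x y V z xRz p₀ = p₀ , lift xRz

  separating-▷ : ∀ x y V → S x y V → sat F (separating x y V) x (var 2 ▷ var 0)
  separating-▷ x y V yS .y _ (lift refl) = V , yS , λ z Vz → lift Vz

  -- Completeness: the J4₊ instance □(p₀ → p₀ ∧ p₁) → (p₂ ▷ p₀ → p₂ ▷ p₀ ∧ p₁)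
  -- under the separating valuation produces a neighbourhood inside V ∩ R[x].
  valid⇒condition : J4+-valid F → J4+-condition F
  valid⇒condition valid x y V yS =
    let p₂▷p₀∧p₁ = valid (var 0) (var 0 ∧' var 1) (var 2) (separating x y V) x
                         (separating-□ x y V) (separating-▷ x y V yS)
        U , yS′ , U⊨p₀∧p₁ = p₂▷p₀∧p₁ y (S-R yS) (lift refl)
    in S-mono yS′ λ z Uz → let lift Vz , lift xRz = U⊨p₀∧p₁ z Uz in Vz , xRz

proposition3p10 : (F : ILSFrame) → J4+-valid F ⇔ J4+-condition F
proposition3p10 F = mk⇔ (valid⇒condition F) (condition⇒valid F)
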